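{- There exist strongly connected digraphs $D$ and $H$ such that $H$ is a spanning subdigraph of $D$ and $\overrightarrow{src}(D)>\overrightarrow{src}(H)$. Likewise, there exist strongly connected digraphs $D'$ and $H'$ such that $H'$ is a spanning subdigraph of $D'$ and $\overrightarrow{srvc}(D')>\overrightarrow{srvc}(H')$.
   Context: All digraphs are finite and simple. A (directed) path is a sequence of distinct vertices $x_0,\dots,x_\ell$ with each $x_{i-1}x_i$ an arc; its length is $\ell$. A digraph is strongly connected if for every ordered pair $(u,v)$ there is a $u$–$v$ path; a $u$–$v$ geodesic is a shortest $u$–$v$ path. An arc-colouring is strongly rainbow connected if every ordered pair $(u,v)$ is joined by a $u$–$v$ geodesic whose arcs have distinct colours; $\overrightarrow{src}(D)$ is the minimum number of colours in such an arc-colouring. A vertex-colouring is strongly rainbow vertex-connected if every ordered pair $(u,v)$ is joined by a $u$–$v$ geodesic whose internal vertices have distinct colours; $\overrightarrow{srvc}(D)$ is the minimum number of colours in such a vertex-colouring. A spanning subdigraph has the same vertex set and a subset of the arcs. -}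

module Defs where

open import Data.Nat using (ℕ; zero; suc; _<_)
open import Data.Fin using (Fin; zero; suc; toℕ; fromℕ; inject₁)
open import Data.Bool using (Bool; true; false)
open import Data.Product using (Σ; ∃; _×_; _,_)
open import Relation.Binary.PropositionalEquality using (_≡_)
open import Relation.Nullary using (¬_)
open import Function.Definitions using (Injective)

-- A finite simple digraph on vertex set Fin n: an irreflexive arc relation
-- (no loops; "no multiple arcs" is automatic for a Bool-valued relation).
record Digraph (n : ℕ) : Set where
  field
    arc      : Fin n → Fin n → Bool
    loopless : ∀ i → arc i i ≡ false
open Digraph public

SpanningSub : {n : ℕ} → Digraph n → Digraph n → Set
SpanningSub H D = ∀ u v → arc H u v ≡ true → arc D u v ≡ true

record Path {n : ℕ} (D : Digraph n) (u v : Fin n) (ℓ : ℕ) : Set where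
  field
    vert     : Fin (suc ℓ) → Fin n
    distinct : Injective _≡_ _≡_ vert
    start    : vert zero ≡ u
    end      : vert (fromℕ ℓ) ≡ v
    step     : (i : Fin ℓ) → arc D (vert (inject₁ i)) (vert (suc i)) ≡ true
open Path public

StronglyConnected : {n : ℕ} → Digraph n → Set
StronglyConnected {n} D = (u v : Fin n) → ∃ λ ℓ → Path D u v ℓ

IsGeodesic : {n : ℕ} (D : Digraph n) (u v : Fin n) (ℓ : ℕ) → Set
IsGeodesic D u v ℓ = (m : ℕ) → m < ℓ → ¬ Path D u v m

-- Arc-colourings with (at most) k colours; colours on non-arcs are irrelevant.
ArcColouring : ℕ → ℕ → Set
ArcColouring n k = Fin n → Fin n → Fin k

ArcRainbow : {n k ℓ : ℕ} {D : Digraph n} {u v : Fin n} →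
             ArcColouring n k → Path D u v ℓ → Set
ArcRainbow {ℓ = ℓ} c p =
  (i j : Fin ℓ) →
  c (vert p (inject₁ i)) (vert p (suc i)) ≡ c (vert p (inject₁ j)) (vert p (suc j)) →
  i ≡ j

StronglyRainbowConnected : {n k : ℕ} → Digraph n → ArcColouring n k → Set
StronglyRainbowConnected {n} D c =
  (u v : Fin n) → ∃ λ ℓ → Σ (Path D u v ℓ) λ p → IsGeodesic D u v ℓ × ArcRainbow c p

IsSrc : {n : ℕ} → Digraph n → ℕ → Set
IsSrc {n} D k =
  (Σ (ArcColouring n k) λ c → StronglyRainbowConnected D c) ×
  ((m : ℕ) → m < k → (c : ArcColouring n m) → ¬ StronglyRainbowConnected D c)

VertexColouring : ℕ → ℕ → Set
VertexColouring n k = Fin n → Fin k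

InternalRainbow : {n k ℓ : ℕ} {D : Digraph n} {u v : Fin n} →
                  VertexColouring n k → Path D u v ℓ → Set
InternalRainbow {ℓ = ℓ} c p =
  (i j : Fin (suc ℓ)) →
  0 < toℕ i → toℕ i < ℓ → 0 < toℕ j → toℕ j < ℓ →
  c (vert p i) ≡ c (vert p j) → i ≡ j

StronglyRainbowVertexConnected : {n k : ℕ} → Digraph n → VertexColouring n k → Set
StronglyRainbowVertexConnected {n} D c =
  (u v : Fin n) → ∃ λ ℓ → Σ (Path D u v ℓ) λ p → IsGeodesic D u v ℓ × InternalRainbow c p

IsSrvc : {n : ℕ} → Digraph n → ℕ → Set
IsSrvc {n} D k =
  (Σ (VertexColouring n k) λ c → StronglyRainbowVertexConnected D c) ×
  ((m : ℕ) → m < k → (c : VertexColouring n m) → ¬ StronglyRainbowVertexConnected D c)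

-- In both examples D is H plus one arc, which makes certain geodesics unique. A strongly rainbow
-- connected colouring must join the ends of a unique geodesic by that geodesic, so it is rainbow there;
-- hence K arcs (internal vertices) any two of which lie on a common unique geodesic get K distinct
-- colours. This gives src(D₁) ≥ 5 from the arcs of the cycle 0→3→6→1→4→0 and srvc(D₂) ≥ 4 from the
-- vertices 0, 3, 4, 5, while one unique geodesic of length 4 gives src(H₁) ≥ 4 and srvc(H₂) ≥ 3.
-- Colourings attaining these bounds are listed; all finite checks are decided by evaluation.
module Submission where

open import Defs
open import Data.Bool using (Bool; true; not; _∧_; _∨_; if_then_else_)
import Data.Bool.Properties as Bool
open import Data.Fin using (Fin; zero; suc; toℕ; fromℕ; fromℕ<; inject₁)
open import Data.Fin.Patterns using (0F; 1F; 2F; 3F; 4F; 5F; 6F)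
open import Data.Fin.Properties using (_≟_; all?; any?; injective⇒≤; toℕ-fromℕ<)
open import Data.List using (List; []; _∷_; [_]; map; concatMap; allFin; upTo)
import Data.List.Relation.Unary.All as All
open import Data.List.Relation.Unary.Any as Any using (Any; satisfied)
open import Data.List.Membership.DecPropositional using () renaming (_∈?_ to member?)
open import Data.Nat using (ℕ; zero; suc; _<_; _≤_; _∸_)
import Data.Nat.Properties as ℕ
open import Data.Product using (Σ; ∃; ∃₂; _×_; _,_; proj₂; uncurry)
import Data.Product.Properties as Product
open import Data.Vec using (Vec; []; _∷_; lookup)
open import Function using (_∘_)
open import Relation.Binary.PropositionalEquality using (_≡_; _≢_; _≗_; refl; sym; trans; cong; cong₂; subst)
open import Relation.Nullary using (¬_; Dec; yes; no; does; contradiction)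
open import Relation.Nullary.Decidable using (True; toWitness; _×-dec_; _→-dec_; ¬?)

private
  variable
    n k ℓ ℓ′ : ℕ

injective? : ∀ {a b} (f : Fin a → Fin b) → Dec (∀ i j → f i ≡ f j → i ≡ j)
injective? f = all? λ i → all? λ j → (f i ≟ f j) →-dec (i ≟ j)

withoutLoops : (Fin n → Fin n → Bool) → Digraph n
arc      (withoutLoops r) u v = not (does (u ≟ v)) ∧ r u v
loopless (withoutLoops r) u with u ≟ u
... | yes _   = refl
... | no u≢u = contradiction refl u≢u

fromArcs : List (Fin n × Fin n) → Digraph n
fromArcs as = withoutLoops λ u v → does (member? (Product.≡-dec _≟_ _≟_) (u , v) as)

addArc : Digraph n → Fin n → Fin n → Digraph n
addArc D a b = withoutLoops λ u v → arc D u v ∨ (does (u ≟ a) ∧ does (v ≟ b))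

spanningSub-addArc : (H : Digraph n) (a b : Fin n) → SpanningSub H (addArc H a b)
spanningSub-addArc H a b u v uv with u ≟ v
... | yes refl = contradiction (trans (sym uv) (loopless H u)) λ ()
... | no _ rewrite uv = refl

Route : ℕ → Set
Route n = ∃ λ ℓ → Vec (Fin n) (suc ℓ)

arcAt : (Fin (suc ℓ) → Fin n) → Fin ℓ → Fin n × Fin n
arcAt x i = x (inject₁ i) , x (suc i)

module _ (D : Digraph n) where

  Walk : ℕ → Fin n → Fin n → Set
  Walk zero    u v = u ≡ v
  Walk (suc m) u v = ∃ λ w → arc D u w ≡ true × Walk m w v

  walk? : ∀ m u v → Dec (Walk m u v)
  walk? zero    u v = u ≟ v
  walk? (suc m) u v = any? λ w → (arc D u w Bool.≟ true) ×-dec walk? m w v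

  Steps : (Fin (suc ℓ) → Fin n) → Set
  Steps {ℓ} x = (i : Fin ℓ) → arc D (x (inject₁ i)) (x (suc i)) ≡ true

  walk-to : (x : Fin (suc ℓ) → Fin n) → Steps x → ∀ k → Walk (toℕ k) (x zero) (x k)
  walk-to         x steps zero    = refl
  walk-to {suc ℓ} x steps (suc k) = x 1F , steps zero , walk-to (x ∘ suc) (steps ∘ suc) k

  walk-from : (x : Fin (suc ℓ) → Fin n) → Steps x → ∀ k → Walk (ℓ ∸ toℕ k) (x k) (x (fromℕ ℓ))
  walk-from {zero}  x steps zero    = refl
  walk-from {suc ℓ} x steps zero    = x 1F , steps zero , walk-from (x ∘ suc) (steps ∘ suc) zero
  walk-from {suc ℓ} x steps (suc k) = walk-from (x ∘ suc) (steps ∘ suc) k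

  module _ {u v : Fin n} (p : Path D u v ℓ) where

    path-prefix : ∀ k → Walk (toℕ k) u (vert p k)
    path-prefix k = subst (λ w → Walk (toℕ k) w (vert p k)) (start p) (walk-to (vert p) (step p) k)

    path-suffix : ∀ k → Walk (ℓ ∸ toℕ k) (vert p k) v
    path-suffix k = subst (Walk (ℓ ∸ toℕ k) (vert p k)) (end p) (walk-from (vert p) (step p) k)

    path⇒walk : Walk ℓ u v
    path⇒walk = subst (λ w → Walk ℓ w v) (start p) (path-suffix zero)

  DistanceAtLeast : ℕ → Fin n → Fin n → Set
  DistanceAtLeast L u v = (m : Fin L) → ¬ Walk (toℕ m) u v

  length≥distance : ∀ {L u v} → DistanceAtLeast L u v → Path D u v ℓ → L ≤ ℓ
  length≥distance far p = ℕ.≮⇒≥ λ ℓ<L →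
    far (fromℕ< ℓ<L) (subst (λ m → Walk m _ _) (sym (toℕ-fromℕ< ℓ<L)) (path⇒walk p))

  distanceAtLeast⇒geodesic : ∀ {u v} → DistanceAtLeast ℓ u v → IsGeodesic D u v ℓ
  distanceAtLeast⇒geodesic far m m<ℓ p = ℕ.<⇒≱ m<ℓ (length≥distance far p)

  geodesic-length : ∀ {u v} → DistanceAtLeast ℓ u v → Path D u v ℓ →
                    (p : Path D u v ℓ′) → IsGeodesic D u v ℓ′ → ℓ′ ≡ ℓ
  geodesic-length far q p geodesic =
    ℕ.≤-antisym (ℕ.≮⇒≥ λ ℓ<ℓ′ → geodesic _ ℓ<ℓ′ q) (length≥distance far p)

  IsPath : Fin n → Fin n → Vec (Fin n) (suc ℓ) → Set
  IsPath {ℓ} u v xs = lookup xs zero ≡ u × lookup xs (fromℕ ℓ) ≡ v ×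
                      (∀ i j → lookup xs i ≡ lookup xs j → i ≡ j) × Steps (lookup xs)

  isPath? : ∀ u v (xs : Vec (Fin n) (suc ℓ)) → Dec (IsPath u v xs)
  isPath? u v xs = (lookup xs zero ≟ u) ×-dec (lookup xs (fromℕ _) ≟ v) ×-dec
                   injective? (lookup xs) ×-dec all? (λ i → arc D _ _ Bool.≟ true)

  toPath : ∀ {u v} (xs : Vec (Fin n) (suc ℓ)) → IsPath u v xs → Path D u v ℓ
  toPath xs (first , last , distinct , steps) = record
    { vert = lookup xs ; distinct = distinct _ _ ; start = first ; end = last ; step = steps }

  Geodesic : Fin n → Fin n → Route n → Set
  Geodesic u v (ℓ , xs) = IsPath u v xs × DistanceAtLeast ℓ u v

  geodesic? : ∀ u v r → Dec (Geodesic u v r)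
  geodesic? u v (ℓ , xs) = isPath? u v xs ×-dec all? λ m → ¬? (walk? (toℕ m) u v)

  -- The k-th vertex of any u–v path of length ℓ qualifies as w, so this makes the route unique.
  Pinned : Fin n → Fin n → Route n → Set
  Pinned u v (ℓ , xs) = ∀ (k : Fin (suc ℓ)) w → Walk (toℕ k) u w → Walk (ℓ ∸ toℕ k) w v → w ≡ lookup xs k

  UniqueGeodesic : Fin n → Fin n → Route n → Set
  UniqueGeodesic u v r = Geodesic u v r × Pinned u v r

  uniqueGeodesic? : ∀ u v r → Dec (UniqueGeodesic u v r)
  uniqueGeodesic? u v r@(ℓ , xs) = geodesic? u v r ×-dec
    (all? λ k → all? λ w → walk? (toℕ k) u w →-dec walk? (ℓ ∸ toℕ k) w v →-dec (w ≟ lookup xs k))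

  pinned-vert : ∀ {u v} (xs : Vec (Fin n) (suc ℓ)) → Pinned u v (ℓ , xs) →
                (p : Path D u v ℓ) → vert p ≗ lookup xs
  pinned-vert xs pinned p k = pinned k (vert p k) (path-prefix p k) (path-suffix p k)

  -- Candidate witnesses for a search.
  walksOfLength : ∀ m → Fin n → Fin n → List (Vec (Fin n) (suc m))
  walksOfLength zero    u v = if does (u ≟ v) then [ u ∷ [] ] else []
  walksOfLength (suc m) u v =
    concatMap (λ w → if arc D u w then map (u ∷_) (walksOfLength m w v) else []) (allFin n)

  candidateRoutes : Fin n → Fin n → List (Route n)
  candidateRoutes u v = concatMap (λ m → map (m ,_) (walksOfLength m u v)) (upTo n)

UniqueGeodesicRoute : Digraph n → Route n → Set
UniqueGeodesicRoute D (ℓ , xs) = UniqueGeodesic D (lookup xs zero) (lookup xs (fromℕ ℓ)) (ℓ , xs)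

uniqueGeodesicRoute? : (D : Digraph n) → ∀ r → Dec (UniqueGeodesicRoute D r)
uniqueGeodesicRoute? D (ℓ , xs) = uniqueGeodesic? D _ _ (ℓ , xs)

SequenceProperty : ℕ → Set₁
SequenceProperty n = ∀ {ℓ} → (Fin (suc ℓ) → Fin n) → Set

RespectsPointwise : SequenceProperty n → Set
RespectsPointwise {n} R = ∀ {ℓ} {x y : Fin (suc ℓ) → Fin n} → x ≗ y → R x → R y

-- StronglyRainbowConnected and StronglyRainbowVertexConnected are instances of this, definitionally.
ConnectedByGeodesics : Digraph n → SequenceProperty n → Set
ConnectedByGeodesics {n} D R =
  (u v : Fin n) → ∃ λ ℓ → Σ (Path D u v ℓ) λ p → IsGeodesic D u v ℓ × R (vert p)

module _ {D : Digraph n} {R : SequenceProperty n} where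

  connectedByGeodesics⇒stronglyConnected : ConnectedByGeodesics D R → StronglyConnected D
  connectedByGeodesics⇒stronglyConnected connected u v with connected u v
  ... | ℓ , p , _ = ℓ , p

  uniqueGeodesic-forces : RespectsPointwise R → ∀ {u v} {xs : Vec (Fin n) (suc ℓ)} →
                          UniqueGeodesic D u v (ℓ , xs) → ConnectedByGeodesics D R → R (lookup xs)
  uniqueGeodesic-forces respects {u} {v} {xs} ((isPath , far) , pinned) connected
    with connected u v
  ... | ℓ , p , geodesic , Rp with geodesic-length D far (toPath D xs isPath) p geodesic
  ...   | refl = respects (pinned-vert D xs pinned p) Rp

  colours≥ : RespectsPointwise R → ConnectedByGeodesics D R → ∀ {K} (f : Fin K → Fin k) →
             (∀ i j → i ≢ j → ∃ λ r → UniqueGeodesicRoute D r × (R (lookup (proj₂ r)) → f i ≢ f j)) →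
             K ≤ k
  colours≥ respects connected f separated = injective⇒≤ λ {i} {j} → injective i j
    where
    injective : ∀ i j → f i ≡ f j → i ≡ j
    injective i j fᵢ≡fⱼ with i ≟ j
    ... | yes i≡j = i≡j
    ... | no i≢j with separated i j i≢j
    ...   | (_ , xs) , unique , separates =
      contradiction fᵢ≡fⱼ (separates (uniqueGeodesic-forces respects {xs = xs} unique connected))

connectedByGeodesics-bySearch :
  (D : Digraph n) {R : SequenceProperty n} (R? : ∀ {ℓ} (x : Fin (suc ℓ) → Fin n) → Dec (R x)) →
  True (all? λ u → all? λ v → Any.any? (λ r → geodesic? D u v r ×-dec R? (lookup (proj₂ r)))
                                      (candidateRoutes D u v)) →
  ConnectedByGeodesics D R
connectedByGeodesics-bySearch D R? found u v with satisfied (toWitness found u v)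
... | (ℓ , xs) , (isPath , far) , Rxs = ℓ , toPath D xs isPath , distanceAtLeast⇒geodesic D far , Rxs

ArcRainbowSeq : ArcColouring n k → SequenceProperty n
ArcRainbowSeq c x = ∀ i j → uncurry c (arcAt x i) ≡ uncurry c (arcAt x j) → i ≡ j

arcRainbow? : (c : ArcColouring n k) (x : Fin (suc ℓ) → Fin n) → Dec (ArcRainbowSeq c x)
arcRainbow? c x = injective? (uncurry c ∘ arcAt x)

arcRainbow-respectsPointwise : (c : ArcColouring n k) → RespectsPointwise (ArcRainbowSeq c)
arcRainbow-respectsPointwise c x≗y rainbow i j eq =
  rainbow i j (trans (cong₂ c (x≗y _) (x≗y _)) (trans eq (sym (cong₂ c (x≗y _) (x≗y _)))))

InternalRainbowSeq : VertexColouring n k → SequenceProperty n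
InternalRainbowSeq c {ℓ} x = (i j : Fin (suc ℓ)) → 0 < toℕ i → toℕ i < ℓ → 0 < toℕ j → toℕ j < ℓ →
                             c (x i) ≡ c (x j) → i ≡ j

internalRainbow? : (c : VertexColouring n k) (x : Fin (suc ℓ) → Fin n) → Dec (InternalRainbowSeq c x)
internalRainbow? {ℓ = ℓ} c x = all? λ i → all? λ j →
  (0 ℕ.<? toℕ i) →-dec (toℕ i ℕ.<? ℓ) →-dec (0 ℕ.<? toℕ j) →-dec (toℕ j ℕ.<? ℓ) →-dec
  (c (x i) ≟ c (x j)) →-dec (i ≟ j)

internalRainbow-respectsPointwise : (c : VertexColouring n k) → RespectsPointwise (InternalRainbowSeq c)
internalRainbow-respectsPointwise c x≗y rainbow i j 0<i i<ℓ 0<j j<ℓ eq =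
  rainbow i j 0<i i<ℓ 0<j j<ℓ (trans (cong c (x≗y i)) (trans eq (sym (cong c (x≗y j)))))

ArcsOnRoute : Fin n × Fin n → Fin n × Fin n → Route n → Set
ArcsOnRoute a b (ℓ , xs) = ∃₂ λ (i j : Fin ℓ) → i ≢ j × arcAt (lookup xs) i ≡ a × arcAt (lookup xs) j ≡ b

arcsOnRoute? : ∀ (a b : Fin n × Fin n) r → Dec (ArcsOnRoute a b r)
arcsOnRoute? a b (ℓ , xs) = any? λ i → any? λ j → ¬? (i ≟ j) ×-dec
  Product.≡-dec _≟_ _≟_ (arcAt (lookup xs) i) a ×-dec Product.≡-dec _≟_ _≟_ (arcAt (lookup xs) j) b

arcsOnRoute-separated : ∀ (c : ArcColouring n k) {a b} r → ArcsOnRoute a b r →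
                        ArcRainbowSeq c (lookup (proj₂ r)) → uncurry c a ≢ uncurry c b
arcsOnRoute-separated c _ (i , j , i≢j , refl , refl) rainbow same = i≢j (rainbow i j same)

arcColours≥ : (D : Digraph n) {K : ℕ} (a : Fin K → Fin n × Fin n) (geodesics : List (Route n)) →
              True (All.all? (uniqueGeodesicRoute? D) geodesics) →
              True (all? λ i → all? λ j → ¬? (i ≟ j) →-dec Any.any? (arcsOnRoute? (a i) (a j)) geodesics) →
              (c : ArcColouring n k) → StronglyRainbowConnected D c → K ≤ k
arcColours≥ D a geodesics unique covered c src =
  colours≥ (arcRainbow-respectsPointwise c) src (uncurry c ∘ a) λ i j i≢j →
    let onRoute          = toWitness covered i j i≢j
        isUnique , arcs = All.lookupAny (toWitness unique) onRoute
    in  Any.lookup onRoute , isUnique , arcsOnRoute-separated c (Any.lookup onRoute) arcs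

InternalVerticesOnRoute : Fin n → Fin n → Route n → Set
InternalVerticesOnRoute a b (ℓ , xs) = ∃₂ λ (i j : Fin (suc ℓ)) →
  0 < toℕ i × toℕ i < ℓ × 0 < toℕ j × toℕ j < ℓ × i ≢ j × lookup xs i ≡ a × lookup xs j ≡ b

internalVerticesOnRoute? : ∀ (a b : Fin n) r → Dec (InternalVerticesOnRoute a b r)
internalVerticesOnRoute? a b (ℓ , xs) = any? λ i → any? λ j →
  (0 ℕ.<? toℕ i) ×-dec (toℕ i ℕ.<? ℓ) ×-dec (0 ℕ.<? toℕ j) ×-dec (toℕ j ℕ.<? ℓ) ×-dec
  ¬? (i ≟ j) ×-dec (lookup xs i ≟ a) ×-dec (lookup xs j ≟ b)

internalVerticesOnRoute-separated : ∀ (c : VertexColouring n k) {a b} r → InternalVerticesOnRoute a b r →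
                                    InternalRainbowSeq c (lookup (proj₂ r)) → c a ≢ c b
internalVerticesOnRoute-separated c _ (i , j , 0<i , i<ℓ , 0<j , j<ℓ , i≢j , refl , refl) rainbow same =
  i≢j (rainbow i j 0<i i<ℓ 0<j j<ℓ same)

vertexColours≥ : (D : Digraph n) {K : ℕ} (a : Fin K → Fin n) (geodesics : List (Route n)) →
                 True (All.all? (uniqueGeodesicRoute? D) geodesics) →
                 True (all? λ i → all? λ j → ¬? (i ≟ j) →-dec
                         Any.any? (internalVerticesOnRoute? (a i) (a j)) geodesics) →
                 (c : VertexColouring n k) → StronglyRainbowVertexConnected D c → K ≤ k
vertexColours≥ D a geodesics unique covered c srvc =
  colours≥ (internalRainbow-respectsPointwise c) srvc (c ∘ a) λ i j i≢j →
    let onRoute              = toWitness covered i j i≢j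
        isUnique , vertices = All.lookupAny (toWitness unique) onRoute
    in  Any.lookup onRoute , isUnique , internalVerticesOnRoute-separated c (Any.lookup onRoute) vertices

isSrc : (D : Digraph n) (c : ArcColouring n k) → StronglyRainbowConnected D c →
        (∀ {m} (c′ : ArcColouring n m) → StronglyRainbowConnected D c′ → k ≤ m) → IsSrc D k
isSrc D c src minimal = (c , src) , λ m m<k c′ src′ → ℕ.<⇒≱ m<k (minimal c′ src′)

isSrvc : (D : Digraph n) (c : VertexColouring n k) → StronglyRainbowVertexConnected D c →
         (∀ {m} (c′ : VertexColouring n m) → StronglyRainbowVertexConnected D c′ → k ≤ m) → IsSrvc D k
isSrvc D c srvc minimal = (c , srvc) , λ m m<k c′ srvc′ → ℕ.<⇒≱ m<k (minimal c′ srvc′)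

H₁ : Digraph 7
H₁ = fromArcs ((0F , 2F) ∷ (0F , 3F) ∷ (1F , 2F) ∷ (1F , 4F) ∷ (2F , 5F) ∷ (3F , 2F) ∷
               (4F , 0F) ∷ (4F , 1F) ∷ (5F , 0F) ∷ (5F , 1F) ∷ (5F , 6F) ∷ (6F , 1F) ∷ [])

D₁ : Digraph 7
D₁ = addArc H₁ 3F 6F

colouringH₁ : ArcColouring 7 4
colouringH₁ 1F 4F = 1F
colouringH₁ 2F 5F = 2F
colouringH₁ 4F 0F = 2F
colouringH₁ 4F 1F = 1F
colouringH₁ 5F 0F = 1F
colouringH₁ 5F 1F = 3F
colouringH₁ 5F 6F = 3F
colouringH₁ 6F 1F = 3F
colouringH₁ _  _  = 0F

colouringD₁ : ArcColouring 7 5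
colouringD₁ 1F 4F = 1F
colouringD₁ 2F 5F = 2F
colouringD₁ 3F 6F = 2F
colouringD₁ 4F 0F = 3F
colouringD₁ 5F 0F = 1F
colouringD₁ 5F 6F = 1F
colouringD₁ 6F 1F = 4F
colouringD₁ _  _  = 0F

H₁-rainbowConnected : StronglyRainbowConnected H₁ colouringH₁
H₁-rainbowConnected = connectedByGeodesics-bySearch H₁ (arcRainbow? colouringH₁) _

D₁-rainbowConnected : StronglyRainbowConnected D₁ colouringD₁
D₁-rainbowConnected = connectedByGeodesics-bySearch D₁ (arcRainbow? colouringD₁) _

H₁-colours≥4 : (c : ArcColouring 7 k) → StronglyRainbowConnected H₁ c → 4 ≤ k
H₁-colours≥4 = arcColours≥ H₁ (lookup ((0F , 2F) ∷ (2F , 5F) ∷ (5F , 1F) ∷ (1F , 4F) ∷ []))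
  ((_ , 0F ∷ 2F ∷ 5F ∷ 1F ∷ 4F ∷ []) ∷ []) _ _

D₁-colours≥5 : (c : ArcColouring 7 k) → StronglyRainbowConnected D₁ c → 5 ≤ k
D₁-colours≥5 = arcColours≥ D₁ (lookup ((0F , 3F) ∷ (3F , 6F) ∷ (6F , 1F) ∷ (1F , 4F) ∷ (4F , 0F) ∷ []))
  ((_ , 6F ∷ 1F ∷ 4F ∷ 0F ∷ 3F ∷ []) ∷ (_ , 4F ∷ 0F ∷ 3F ∷ 6F ∷ []) ∷ (_ , 3F ∷ 6F ∷ 1F ∷ 4F ∷ []) ∷ []) _ _

H₂ : Digraph 7
H₂ = fromArcs ((0F , 1F) ∷ (1F , 2F) ∷ (1F , 5F) ∷ (2F , 4F) ∷ (3F , 4F) ∷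
               (3F , 6F) ∷ (4F , 5F) ∷ (5F , 0F) ∷ (5F , 3F) ∷ (6F , 0F) ∷ [])

D₂ : Digraph 7
D₂ = addArc H₂ 0F 3F

colouringH₂ : VertexColouring 7 3
colouringH₂ = lookup (0F ∷ 1F ∷ 2F ∷ 0F ∷ 1F ∷ 2F ∷ 2F ∷ [])

colouringD₂ : VertexColouring 7 4
colouringD₂ = lookup (0F ∷ 1F ∷ 0F ∷ 1F ∷ 2F ∷ 3F ∷ 2F ∷ [])

H₂-rainbowConnected : StronglyRainbowVertexConnected H₂ colouringH₂
H₂-rainbowConnected = connectedByGeodesics-bySearch H₂ (internalRainbow? colouringH₂) _

D₂-rainbowConnected : StronglyRainbowVertexConnected D₂ colouringD₂
D₂-rainbowConnected = connectedByGeodesics-bySearch D₂ (internalRainbow? colouringD₂) _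

H₂-colours≥3 : (c : VertexColouring 7 k) → StronglyRainbowVertexConnected H₂ c → 3 ≤ k
H₂-colours≥3 = vertexColours≥ H₂ (lookup (4F ∷ 5F ∷ 0F ∷ [])) ((_ , 2F ∷ 4F ∷ 5F ∷ 0F ∷ 1F ∷ []) ∷ []) _ _

D₂-colours≥4 : (c : VertexColouring 7 k) → StronglyRainbowVertexConnected D₂ c → 4 ≤ k
D₂-colours≥4 = vertexColours≥ D₂ (lookup (0F ∷ 3F ∷ 4F ∷ 5F ∷ []))
  ((_ , 2F ∷ 4F ∷ 5F ∷ 0F ∷ 1F ∷ []) ∷ (_ , 6F ∷ 0F ∷ 3F ∷ 4F ∷ []) ∷ (_ , 2F ∷ 4F ∷ 5F ∷ 3F ∷ 6F ∷ []) ∷ []) _ _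

lemma5 : (∃ λ n → Σ (Digraph n) λ D → Σ (Digraph n) λ H →
    StronglyConnected D × StronglyConnected H × SpanningSub H D ×
    ∃ λ kD → ∃ λ kH → IsSrc D kD × IsSrc H kH × kH < kD)
    ×
    (∃ λ n → Σ (Digraph n) λ D′ → Σ (Digraph n) λ H′ →
    StronglyConnected D′ × StronglyConnected H′ × SpanningSub H′ D′ ×
    ∃ λ kD → ∃ λ kH → IsSrvc D′ kD × IsSrvc H′ kH × kH < kD)
lemma5 =
  ( 7 , D₁ , H₁
  , connectedByGeodesics⇒stronglyConnected D₁-rainbowConnected
  , connectedByGeodesics⇒stronglyConnected H₁-rainbowConnected
  , spanningSub-addArc H₁ 3F 6F
  , 5 , 4
  , isSrc D₁ colouringD₁ D₁-rainbowConnected D₁-colours≥5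
  , isSrc H₁ colouringH₁ H₁-rainbowConnected H₁-colours≥4
  , ℕ.n<1+n 4 )
  ,
  ( 7 , D₂ , H₂
  , connectedByGeodesics⇒stronglyConnected D₂-rainbowConnected
  , connectedByGeodesics⇒stronglyConnected H₂-rainbowConnected
  , spanningSub-addArc H₂ 0F 3F
  , 4 , 3
  , isSrvc D₂ colouringD₂ D₂-rainbowConnected D₂-colours≥4
  , isSrvc H₂ colouringH₂ H₂-rainbowConnected H₂-colours≥3
  , ℕ.n<1+n 3 )
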